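{- Let $G$ be a double star. Then $\gamma_{maj}(G)=DOM^+_{maj}(G)$.
   Context: A double star is the graph obtained from two disjoint stars by joining their central vertices by an edge. For a graph $G=(V,E)$, $N[v]$ denotes the closed neighborhood of $v$; for $f:V\to\{ -1,1\}$ and $X\subseteq V$, $f(X)=\sum_{v\in X}f(v)$. A majority dominating function of $G$ is $f:V\to\{ -1,1\}$ with $|\{v\in V: f(N[v])\geq1\}|\geq|V|/2$; its weight is $f(V)$; $\gamma_{maj}(G)$ is the minimum weight of a majority dominating function of $G$. For a digraph $D=(V,A)$ (finite, no loops, no multiple arcs), $N^+[u]=\{u\}\cup\{v: uv\in A\}$; a majority out-dominating function (MODF) of $D$ is $f:V\to\{ -1,1\}$ with $|\{v: f(N^+[v])\geq1\}|\geq|V|/2$, and $\gamma^+_{maj}(D)$ is the minimum weight $f(V)$ of a MODF. An orientation of $G$ is a digraph obtained by replacing each edge $uv$ by exactly one of the arcs $uv$, $vu$. $DOM^+_{maj}(G)$ is the maximum of $\gamma^+_{maj}(D)$ over all orientations $D$ of $G$. -}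

module Defs where

open import Data.Bool using (Bool; true; false; _∨_; _∧_; if_then_else_; T)
open import Data.Nat as ℕ using (ℕ; zero; suc; _+_; _*_)
open import Data.Nat.Properties using () renaming (_≟_ to _≟ℕ_)
import Data.Nat as N
open import Data.Integer as ℤ using (ℤ; +_; -_)
open import Data.Fin using (Fin; toℕ)
open import Data.Fin.Properties using () renaming (_≟_ to _≟F_)
open import Data.List using (List; length; filter; map; foldr)
open import Data.List using () renaming (sum to sumℕ)
open import Data.List.Base using (allFin)
open import Data.Product using (Σ; ∃; _×_; _,_)
open import Relation.Nullary using (¬_)
open import Relation.Nullary.Decidable using (⌊_⌋; does)
open import Relation.Binary.PropositionalEquality using (_≡_)

Rel₂ : ℕ → Set
Rel₂ n = Fin n → Fin n → Bool

-- value of a {-1,1}-valued function: true ↦ 1, false ↦ -1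
val : Bool → ℤ
val true  = + 1
val false = - (+ 1)

sumℤ : List ℤ → ℤ
sumℤ = foldr ℤ._+_ (+ 0)

-- f(X) where X = {u : P u}
fSum : ∀ {n} → (Fin n → Bool) → (Fin n → Bool) → ℤ
fSum {n} f P = sumℤ (map (λ u → if P u then val (f u) else + 0) (allFin n))

weight : ∀ {n} → (Fin n → Bool) → ℤ
weight f = fSum f (λ _ → true)

-- membership in N[v] (for a graph) / N⁺[v] (for a digraph) with relation R:
-- u ∈ N_R[v] iff u = v or R v u
closedNbhd : ∀ {n} → Rel₂ n → Fin n → Fin n → Bool
closedNbhd R v u = ⌊ u ≟F v ⌋ ∨ R v u

goodCount : ∀ {n} → Rel₂ n → (Fin n → Bool) → ℕ
goodCount {n} R f =
  length (filter (λ v → (+ 1) ℤ.≤? fSum f (closedNbhd R v)) (allFin n))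

IsMajDom : ∀ {n} → Rel₂ n → (Fin n → Bool) → Set
IsMajDom {n} R f = n N.≤ 2 * goodCount R f

IsMinMajWeight : ∀ {n} → Rel₂ n → ℤ → Set
IsMinMajWeight {n} R k =
  (Σ (Fin n → Bool) λ f → IsMajDom R f × weight f ≡ k)
  × (∀ (f : Fin n → Bool) → IsMajDom R f → k ℤ.≤ weight f)

IsGammaMaj : ∀ {n} → Rel₂ n → ℤ → Set
IsGammaMaj = IsMinMajWeight

IsGammaOutMaj : ∀ {n} → Rel₂ n → ℤ → Set
IsGammaOutMaj = IsMinMajWeight

IsOrientation : ∀ {n} → Rel₂ n → Rel₂ n → Set
IsOrientation {n} G D =
  (∀ u v → T (D u v) → T (G u v))
  × (∀ u v → T (G u v) → (T (D u v) × ¬ T (D v u)) Data.Sum.⊎ (¬ T (D u v) × T (D v u)))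
  where import Data.Sum

IsDOMOutMaj : ∀ {n} → Rel₂ n → ℤ → Set
IsDOMOutMaj {n} G k =
  (Σ (Rel₂ n) λ D → IsOrientation G D × IsGammaOutMaj D k)
  × (∀ (D : Rel₂ n) (k' : ℤ) → IsOrientation G D → IsGammaOutMaj D k' → k' ℤ.≤ k)

-- The double star S(p,q) on vertex set Fin (2 + p + q):
-- vertex 0 and 1 are the two (adjacent) centres, vertices 2 … p+1 are the
-- leaves attached to 0 and vertices p+2 … p+q+1 the leaves attached to 1.
dsEdge : ℕ → ℕ → ℕ → Bool
dsEdge p 0 1 = true
dsEdge p 0 (suc (suc i)) = ⌊ i N.<? p ⌋
dsEdge p 1 (suc (suc i)) = ⌊ p N.≤? i ⌋
dsEdge p _ _ = false

doubleStar : (p q : ℕ) → Rel₂ (2 + p + q)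
doubleStar p q u v = dsEdge p (toℕ u) (toℕ v) ∨ dsEdge p (toℕ v) (toℕ u)

-- A ±1-function with F⁺ positive and F⁻ negative vertices has weight |F⁺| − |F⁻|, and
-- majority domination means n ≤ 2·#good.  So whenever #good ≤ |F⁺| the weight is a
-- nonnegative integer of the parity of n, hence at least n mod 2; it equals n mod 2 when
-- |F⁺| = ⌈n/2⌉ and every positive vertex is good.
--
-- In a double star #good ≤ |F⁺| holds star by star: a good leaf and its centre are positive,
-- and a good negative centre has a positive leaf while none of its leaves is good.  The
-- centre of a largest star with ⌈n/2⌉ − 1 of its leaves attains n mod 2.  The vertices of any
-- orientation fall into four levels along which arcs descend, so it has an out-closed set of
-- size ⌈n/2⌉, all of whose vertices are good: every orientation has minimum at most n mod 2.
-- Orienting each edge towards one centre leaves out-degree at most 1, where only positive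
-- vertices can be good, so that orientation has minimum exactly n mod 2.

module Submission where

open import Defs
open import Data.Bool using (Bool; true; false; T; not; _∧_; _∨_; if_then_else_)
open import Data.Bool.Properties using (T-∧; T-∨; T?; ∨-comm)
open import Data.Empty using (⊥-elim)
open import Data.Fin using (Fin; zero; suc; toℕ; _↑ˡ_; _↑ʳ_; splitAt)
import Data.Fin.Properties as Finₚ
open import Data.Integer as ℤ using (ℤ; _⊖_)
import Data.Integer.Properties as ℤₚ
open import Data.List using (filter; length; map; tabulate)
open import Data.Nat
  using (ℕ; zero; suc; _+_; _*_; _≤_; _<_; _≥_; z≤n; s≤s; s≤s⁻¹; _%_; ⌊_/2⌋; ⌈_/2⌉)
open import Data.Nat.DivMod using (m%n≤m)
open import Data.Nat.Properties
open import Algebra.Properties.CommutativeSemigroup +-commutativeSemigroup using (interchange)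
open import Data.Product using (Σ; ∃; _×_; _,_; proj₁; proj₂; uncurry)
open import Data.Sum using (_⊎_; inj₁; inj₂; map₁; map₂; [_,_]; swap)
import Data.Vec.Functional as Vector
open import Function using (_∘_; _⇔_; Equivalence; mk⇔)
open import Relation.Binary.PropositionalEquality hiding ([_])
open import Relation.Nullary using (¬_; yes; no; contradiction)
open import Relation.Nullary.Decidable using (⌊_⌋; toWitness; fromWitness)
open import Relation.Unary using (Pred; Decidable)

open Equivalence using (to; from)

T-not⇔¬T : ∀ {b} → T (not b) ⇔ (¬ T b)
T-not⇔¬T {true}  = mk⇔ (λ ()) (λ ¬⊤ → ¬⊤ _)
T-not⇔¬T {false} = mk⇔ (λ _ ()) (λ _ → _)

if-T : ∀ {a} {A : Set a} {b} {x y : A} → T b → (if b then x else y) ≡ x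
if-T {b = true} _ = refl

if-¬T : ∀ {a} {A : Set a} {b} {x y : A} → ¬ T b → (if b then x else y) ≡ y
if-¬T {b = true}  ¬b = ⊥-elim (¬b _)
if-¬T {b = false} _  = refl

if-≤ : ∀ b {x y z} → x ≤ z → y ≤ z → (if b then x else y) ≤ z
if-≤ true  x≤z _   = x≤z
if-≤ false _   y≤z = y≤z

-- Counting on Fin k

count : ∀ {k} → (Fin k → Bool) → ℕ
count {zero}  g = 0
count {suc k} g = (if g zero then 1 else 0) + count (g ∘ suc)

infix 4 _⊆ᵇ_

_⊆ᵇ_ : ∀ {k} → (Fin k → Bool) → (Fin k → Bool) → Set
g ⊆ᵇ h = ∀ i → T (g i) → T (h i)

count-mono : ∀ {k} {g h : Fin k → Bool} → g ⊆ᵇ h → count g ≤ count h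
count-mono {zero}  g⊆h = z≤n
count-mono {suc k} {g} {h} g⊆h with g zero in g₀ | h zero in h₀
... | false | false = count-mono (g⊆h ∘ suc)
... | false | true  = m≤n⇒m≤1+n (count-mono (g⊆h ∘ suc))
... | true  | true  = s≤s (count-mono (g⊆h ∘ suc))
... | true  | false = ⊥-elim (subst T h₀ (g⊆h zero (subst T (sym g₀) _)))

count-cong : ∀ {k} {g h : Fin k → Bool} → g ⊆ᵇ h → h ⊆ᵇ g → count g ≡ count h
count-cong g⊆h h⊆g = ≤-antisym (count-mono g⊆h) (count-mono h⊆g)

count-none : ∀ {k} {g : Fin k → Bool} → (∀ i → ¬ T (g i)) → count g ≡ 0
count-none {zero}  none = refl
count-none {suc k} {g} none with g zero in g₀
... | false = count-none (none ∘ suc)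
... | true  = ⊥-elim (none zero (subst T (sym g₀) _))

count-all : ∀ {k} {g : Fin k → Bool} → (∀ i → T (g i)) → count g ≡ k
count-all {zero}  all = refl
count-all {suc k} {g} all with g zero in g₀
... | true  = cong suc (count-all (all ∘ suc))
... | false = ⊥-elim (subst T g₀ (all zero))

count-pos : ∀ {k} {g : Fin k → Bool} i → T (g i) → 1 ≤ count g
count-pos {suc k} {g} zero gi with g zero
... | true = s≤s z≤n
count-pos {suc k} {g} (suc i) gi = ≤-trans (count-pos i gi) (m≤n+m _ _)

count≤1 : ∀ {k} {g : Fin k → Bool} w → (∀ i → T (g i) → i ≡ w) → count g ≤ 1
count≤1 {suc k} {g} zero only
  rewrite count-none {g = g ∘ suc} (λ i gi → Finₚ.0≢1+n (sym (only (suc i) gi)))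
  with g zero
... | true  = s≤s z≤n
... | false = z≤n
count≤1 {suc k} {g} (suc w) only with g zero in g₀
... | false = count≤1 w (λ i gi → Finₚ.suc-injective (only (suc i) gi))
... | true  = ⊥-elim (Finₚ.0≢1+n (only zero (subst T (sym g₀) _)))

count≤k : ∀ {k} (g : Fin k → Bool) → count g ≤ k
count≤k g = ≤-trans (count-mono {g = g} {h = λ _ → true} (λ _ _ → _))
                    (≤-reflexive (count-all {g = λ _ → true} (λ _ → _)))

count-split : ∀ {k} (g h : Fin k → Bool) →
              count g ≡ count (λ i → g i ∧ h i) + count (λ i → g i ∧ not (h i))
count-split {zero}  g h = refl
count-split {suc k} g h with g zero | h zero
... | false | _     = count-split (g ∘ suc) (h ∘ suc)
... | true  | true  = cong suc (count-split (g ∘ suc) (h ∘ suc))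
... | true  | false = trans (cong suc (count-split (g ∘ suc) (h ∘ suc))) (sym (+-suc _ _))

count-complement : ∀ {k} (g : Fin k → Bool) → count g + count (not ∘ g) ≡ k
count-complement g = sym (trans (sym (count-all {g = λ _ → true} _)) (count-split (λ _ → true) g))

count-++ : ∀ m {n} (g : Fin (m + n) → Bool) → count g ≡ count (g ∘ (_↑ˡ n)) + count (g ∘ (m ↑ʳ_))
count-++ zero    g = refl
count-++ (suc m) g = trans (cong ((if g zero then 1 else 0) +_) (count-++ m (g ∘ suc)))
                           (sym (+-assoc (if g zero then 1 else 0) _ _))

Between : ∀ {k} → (Fin k → Bool) → (Fin k → Bool) → ℕ → Set
Between S P r = ∃ λ Q → S ⊆ᵇ Q × Q ⊆ᵇ P × count Q ≡ r

⊆ᵇ-cons : ∀ {k} {g h : Fin (suc k) → Bool} → (T (g zero) → T (h zero)) → g ∘ suc ⊆ᵇ h ∘ suc → g ⊆ᵇ h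
⊆ᵇ-cons g₀⊆h₀ _   zero    = g₀⊆h₀
⊆ᵇ-cons _     g⊆h (suc i) = g⊆h i

between-cons : ∀ {k} {S P : Fin (suc k) → Bool} b {r} → (T (S zero) → T b) → (T b → T (P zero)) →
               Between (S ∘ suc) (P ∘ suc) r → Between S P ((if b then 1 else 0) + r)
between-cons b S₀⇒b b⇒P₀ (Q , S⊆Q , Q⊆P , ∣Q∣) =
  (b Vector.∷ Q) , ⊆ᵇ-cons S₀⇒b S⊆Q , ⊆ᵇ-cons b⇒P₀ Q⊆P , cong ((if b then 1 else 0) +_) ∣Q∣

-- Greedy: 0 joins Q when S forces it or when the rest of P alone cannot reach r.
subset-between : ∀ {k} {S P : Fin k → Bool} {r} → S ⊆ᵇ P → count S ≤ r → r ≤ count P → Between S P r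
subset-between {zero} {S} _ _ r≤0 = S , (λ _ x → x) , (λ ()) , sym (n≤0⇒n≡0 r≤0)
subset-between {suc k} {S} {P} {r} S⊆P S≤r r≤P with S zero in s₀ | P zero in p₀
... | true  | false = ⊥-elim (subst T p₀ (S⊆P zero (subst T (sym s₀) _)))
... | false | false = between-cons false (subst T s₀) (λ ()) (subset-between (S⊆P ∘ suc) S≤r r≤P)
... | true  | true with s≤s S′≤r′ ← S≤r =
  between-cons true _ (λ _ → subst T (sym p₀) _) (subset-between (S⊆P ∘ suc) S′≤r′ (s≤s⁻¹ r≤P))
... | false | true with r ≤? count (P ∘ suc)
...   | yes r≤P′ = between-cons false (subst T s₀) (λ ()) (subset-between (S⊆P ∘ suc) S≤r r≤P′)
...   | no  r≰P′ with s≤s P′≤r′ ← ≰⇒> r≰P′ =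
  between-cons true _ (λ _ → subst T (sym p₀) _)
    (subset-between (S⊆P ∘ suc) (≤-trans (count-mono (S⊆P ∘ suc)) P′≤r′) (s≤s⁻¹ r≤P))

-- Weights and good vertices

length-filter-tabulate : ∀ {a p k} {A : Set a} {P : Pred A p} (P? : Decidable P) (t : Fin k → A) →
                         length (filter P? (tabulate t)) ≡ count (λ i → ⌊ P? (t i) ⌋)
length-filter-tabulate {k = zero}  P? t = refl
length-filter-tabulate {k = suc k} P? t with P? (t zero)
... | yes _ = cong suc (length-filter-tabulate P? (t ∘ suc))
... | no  _ = length-filter-tabulate P? (t ∘ suc)

signed-term-+ : ∀ x y m n →
  (if x then val y else ℤ.+ 0) ℤ.+ (m ⊖ n)
    ≡ ((if x ∧ y then 1 else 0) + m) ⊖ ((if x ∧ not y then 1 else 0) + n)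
signed-term-+ false _     m n = ℤₚ.+-identityˡ (m ⊖ n)
signed-term-+ true  true  m n = ℤₚ.distribʳ-⊖-+-pos 1 m n
signed-term-+ true  false m n = ℤₚ.distribʳ-⊖-+-neg 0 m n

sumℤ-signs-tabulate : ∀ {n k} (f X : Fin n → Bool) (t : Fin k → Fin n) →
  sumℤ (map (λ u → if X u then val (f u) else ℤ.+ 0) (tabulate t))
    ≡ count (λ i → X (t i) ∧ f (t i)) ⊖ count (λ i → X (t i) ∧ not (f (t i)))
sumℤ-signs-tabulate {k = zero}  f X t = refl
sumℤ-signs-tabulate {k = suc k} f X t =
  trans (cong (ℤ._+_ (if X (t zero) then val (f (t zero)) else ℤ.+ 0))
              (sumℤ-signs-tabulate f X (t ∘ suc)))
        (signed-term-+ (X (t zero)) (f (t zero)) _ _)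

fSum≡positives⊖negatives : ∀ {n} (f X : Fin n → Bool) →
                           fSum f X ≡ count (λ u → X u ∧ f u) ⊖ count (λ u → X u ∧ not (f u))
fSum≡positives⊖negatives f X = sumℤ-signs-tabulate f X (λ u → u)

weight≡positives⊖negatives : ∀ {n} (f : Fin n → Bool) → weight f ≡ count f ⊖ count (not ∘ f)
weight≡positives⊖negatives f = fSum≡positives⊖negatives f (λ _ → true)

+1≤m⊖n⇔n<m : ∀ m n → ℤ.+ 1 ℤ.≤ m ⊖ n ⇔ n < m
+1≤m⊖n⇔n<m m n = mk⇔ to′ from′
  where
  to′ : ℤ.+ 1 ℤ.≤ m ⊖ n → n < m
  to′ 1≤m⊖n with n <? m
  ... | yes n<m = n<m
  ... | no  n≮m = contradiction (ℤₚ.≤-trans 1≤m⊖n m⊖n≤0) λ { (ℤ.+≤+ ()) }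
    where m⊖n≤0 = subst (m ⊖ n ℤ.≤_) (ℤₚ.n⊖n≡0 m) (ℤₚ.⊖-monoʳ-≥-≤ m (≮⇒≥ n≮m))
  from′ : n < m → ℤ.+ 1 ℤ.≤ m ⊖ n
  from′ n<m rewrite ℤₚ.⊖-≥ (<⇒≤ n<m) = ℤ.+≤+ (m<n⇒0<n∸m n<m)

good : ∀ {n} → Rel₂ n → (Fin n → Bool) → Fin n → Bool
good R f v = ⌊ ℤ.+ 1 ℤ.≤? fSum f (closedNbhd R v) ⌋

goodCount≡count-good : ∀ {n} (R : Rel₂ n) (f : Fin n → Bool) → goodCount R f ≡ count (good R f)
goodCount≡count-good R f =
  length-filter-tabulate (λ v → ℤ.+ 1 ℤ.≤? fSum f (closedNbhd R v)) (λ v → v)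

good⇔more-positive : ∀ {n} (R : Rel₂ n) (f : Fin n → Bool) v →
  T (good R f v) ⇔
    count (λ u → closedNbhd R v u ∧ not (f u)) < count (λ u → closedNbhd R v u ∧ f u)
good⇔more-positive R f v =
  mk⇔ (to (+1≤m⊖n⇔n<m _ _) ∘ subst (ℤ.+ 1 ℤ.≤_) fSum≡ ∘ toWitness {a? = 1≤?fSum})
      (fromWitness {a? = 1≤?fSum} ∘ subst (ℤ.+ 1 ℤ.≤_) (sym fSum≡) ∘ from (+1≤m⊖n⇔n<m _ _))
  where
  1≤?fSum = ℤ.+ 1 ℤ.≤? fSum f (closedNbhd R v)
  fSum≡ = fSum≡positives⊖negatives f (closedNbhd R v)

self∈closedNbhd : ∀ {n} (R : Rel₂ n) v → T (closedNbhd R v v)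
self∈closedNbhd R v = from T-∨ (inj₁ (fromWitness {a? = v Finₚ.≟ v} refl))

∈closedNbhd⇒ : ∀ {n} (R : Rel₂ n) v u → T (closedNbhd R v u) → u ≡ v ⊎ T (R v u)
∈closedNbhd⇒ R v u = map₁ (toWitness {a? = u Finₚ.≟ v}) ∘ to T-∨

≢⇒T-not-≟ : ∀ {n} {u v : Fin n} → u ≢ v → T (not ⌊ u Finₚ.≟ v ⌋)
≢⇒T-not-≟ {u = u} {v} u≢v = from T-not⇔¬T (u≢v ∘ toWitness {a? = u Finₚ.≟ v})

adj⇒∈closedNbhd : ∀ {n} (R : Rel₂ n) v u → T (R v u) → T (closedNbhd R v u)
adj⇒∈closedNbhd R v u = from (T-∨ {⌊ u Finₚ.≟ v ⌋}) ∘ inj₂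

closedNbhd⊆positive⇒good : ∀ {n} (R : Rel₂ n) (f : Fin n → Bool) v →
                           closedNbhd R v ⊆ᵇ f → T (good R f v)
closedNbhd⊆positive⇒good R f v N⊆f = from (good⇔more-positive R f v) (begin-strict
  count (λ u → closedNbhd R v u ∧ not (f u)) ≡⟨ count-none (λ u u∈N⁻ →
    let u∈N , ¬fu = to T-∧ u∈N⁻ in to T-not⇔¬T ¬fu (N⊆f u u∈N)) ⟩
  0                                          <⟨ count-pos v (from T-∧ (v∈N , N⊆f v v∈N)) ⟩
  count (λ u → closedNbhd R v u ∧ f u)       ∎)
  where
  open ≤-Reasoning
  v∈N = self∈closedNbhd R v

≤1-positive⇒¬good : ∀ {n} (R : Rel₂ n) (f : Fin n → Bool) {v} x w →
  T (closedNbhd R v x) → ¬ T (f x) →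
  (∀ u → T (closedNbhd R v u) → T (f u) → u ≡ w) → ¬ T (good R f v)
≤1-positive⇒¬good R f {v} x w x∈N ¬fx only-w v-good = <-irrefl refl (begin-strict
  1                                          ≤⟨ count-pos x (from T-∧ (x∈N , from T-not⇔¬T ¬fx)) ⟩
  count (λ u → closedNbhd R v u ∧ not (f u)) <⟨ to (good⇔more-positive R f v) v-good ⟩
  count (λ u → closedNbhd R v u ∧ f u)       ≤⟨ count≤1 w (λ u → uncurry (only-w u) ∘ to T-∧) ⟩
  1                                          ∎)
  where open ≤-Reasoning

good⇒positive-in-pair-closedNbhd : ∀ {n} (R : Rel₂ n) (f : Fin n → Bool) {v} a b →
  (∀ u → T (closedNbhd R v u) → u ≡ a ⊎ u ≡ b) → T (closedNbhd R v a) →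
  T (good R f v) → T (f a)
good⇒positive-in-pair-closedNbhd R f a b N⊆ab a∈N v-good with T? (f a)
... | yes fa  = fa
... | no  ¬fa = ⊥-elim (≤1-positive⇒¬good R f a b a∈N ¬fa only-b v-good)
  where
  only-b : ∀ u → T (closedNbhd R _ u) → T (f u) → u ≡ b
  only-b u u∈N fu = [ (λ { refl → ⊥-elim (¬fa fu) }) , (λ u≡b → u≡b) ] (N⊆ab u u∈N)

⌈n/2⌉⊖⌊n/2⌋≡n%2 : ∀ n → ⌈ n /2⌉ ⊖ ⌊ n /2⌋ ≡ ℤ.+ (n % 2)
⌈n/2⌉⊖⌊n/2⌋≡n%2 zero          = refl
⌈n/2⌉⊖⌊n/2⌋≡n%2 (suc zero)    = refl
⌈n/2⌉⊖⌊n/2⌋≡n%2 (suc (suc n)) = trans (ℤₚ.[1+m]⊖[1+n]≡m⊖n ⌈ n /2⌉ ⌊ n /2⌋) (⌈n/2⌉⊖⌊n/2⌋≡n%2 n)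

[m+n]%2≤m⊖n : ∀ m n → n ≤ m → ℤ.+ ((m + n) % 2) ℤ.≤ m ⊖ n
[m+n]%2≤m⊖n m       zero    _ =
  ℤ.+≤+ (subst (λ k → k % 2 ≤ m) (sym (+-identityʳ m)) (m%n≤m m 2))
[m+n]%2≤m⊖n (suc m) (suc n) (s≤s n≤m) rewrite +-suc m n | ℤₚ.[1+m]⊖[1+n]≡m⊖n m n =
  [m+n]%2≤m⊖n m n n≤m

n≤⌈n/2⌉+⌈n/2⌉ : ∀ n → n ≤ ⌈ n /2⌉ + ⌈ n /2⌉
n≤⌈n/2⌉+⌈n/2⌉ n = subst (_≤ ⌈ n /2⌉ + ⌈ n /2⌉) (⌊n/2⌋+⌈n/2⌉≡n n) (+-monoˡ-≤ ⌈ n /2⌉ (⌊n/2⌋≤⌈n/2⌉ n))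

⌈n/2⌉≤m : ∀ {n m} → n ≤ m + m → ⌈ n /2⌉ ≤ m
⌈n/2⌉≤m {zero}              _ = z≤n
⌈n/2⌉≤m {suc zero} {suc m}  _ = s≤s z≤n
⌈n/2⌉≤m {suc (suc n)} {suc m} (s≤s n+1≤m+m+1) rewrite +-suc m m = s≤s (⌈n/2⌉≤m (s≤s⁻¹ n+1≤m+m+1))

module _ {n} (R : Rel₂ n) where

  parity≤weight : ∀ f → IsMajDom R f → count (good R f) ≤ count f → ℤ.+ (n % 2) ℤ.≤ weight f
  parity≤weight f majority good≤pos = subst₂ ℤ._≤_
    (cong (λ k → ℤ.+ (k % 2)) (count-complement f)) (sym (weight≡positives⊖negatives f))
    ([m+n]%2≤m⊖n _ _ (+-cancelˡ-≤ (count f) _ _ (begin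
      count f + count (not ∘ f)  ≡⟨ count-complement f ⟩
      n                          ≤⟨ majority ⟩
      2 * goodCount R f          ≡⟨ cong (2 *_) (goodCount≡count-good R f) ⟩
      2 * count (good R f)       ≤⟨ *-monoʳ-≤ 2 good≤pos ⟩
      2 * count f                ≡⟨ cong (count f +_) (+-identityʳ (count f)) ⟩
      count f + count f          ∎)))
    where open ≤-Reasoning

  ⌈n/2⌉-good-positives⇒isMajDom : ∀ f → count f ≡ ⌈ n /2⌉ → f ⊆ᵇ good R f →
                                   IsMajDom R f × weight f ≡ ℤ.+ (n % 2)
  ⌈n/2⌉-good-positives⇒isMajDom f ∣f∣ f⊆good = majority , weight≡
    where
    open ≤-Reasoning
    majority : n ≤ 2 * goodCount R f
    majority = begin
      n                        ≤⟨ n≤⌈n/2⌉+⌈n/2⌉ n ⟩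
      ⌈ n /2⌉ + ⌈ n /2⌉        ≡⟨ cong₂ _+_ ∣f∣ (trans (+-identityʳ (count f)) ∣f∣) ⟨
      2 * count f              ≤⟨ *-monoʳ-≤ 2 (count-mono f⊆good) ⟩
      2 * count (good R f)     ≡⟨ cong (2 *_) (goodCount≡count-good R f) ⟨
      2 * goodCount R f        ∎
    ∣¬f∣ : count (not ∘ f) ≡ ⌊ n /2⌋
    ∣¬f∣ = +-cancelˡ-≡ ⌈ n /2⌉ _ _ (begin-equality
      ⌈ n /2⌉ + count (not ∘ f)  ≡⟨ cong (_+ count (not ∘ f)) ∣f∣ ⟨
      count f + count (not ∘ f)  ≡⟨ count-complement f ⟩
      n                          ≡⟨ ⌊n/2⌋+⌈n/2⌉≡n n ⟨
      ⌊ n /2⌋ + ⌈ n /2⌉          ≡⟨ +-comm ⌊ n /2⌋ ⌈ n /2⌉ ⟩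
      ⌈ n /2⌉ + ⌊ n /2⌋          ∎)
    weight≡ : weight f ≡ ℤ.+ (n % 2)
    weight≡ = trans (weight≡positives⊖negatives f)
                    (trans (cong₂ _⊖_ ∣f∣ ∣¬f∣) (⌈n/2⌉⊖⌊n/2⌋≡n%2 n))

  parity-isMinMajWeight : (∀ f → count (good R f) ≤ count f) →
                          (∃ λ f → count f ≡ ⌈ n /2⌉ × f ⊆ᵇ good R f) →
                          IsMinMajWeight R (ℤ.+ (n % 2))
  parity-isMinMajWeight good≤pos (f , ∣f∣ , f⊆good) =
    (f , ⌈n/2⌉-good-positives⇒isMajDom f ∣f∣ f⊆good) ,
    λ g majority → parity≤weight g majority (good≤pos g)

-- Out-closed sets

OutClosed : ∀ {n} → Rel₂ n → (Fin n → Bool) → Set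
OutClosed R S = ∀ u v → T (S u) → T (R u v) → T (S v)

outClosed⇒positive⊆good : ∀ {n} (R : Rel₂ n) S → OutClosed R S → S ⊆ᵇ good R S
outClosed⇒positive⊆good R S closed v v∈S = closedNbhd⊆positive⇒good R S v λ u u∈N →
  [ (λ { refl → v∈S }) , closed v u v∈S ] (∈closedNbhd⇒ R v u u∈N)

-- Every set squeezed between {v : rank v < t} and {v : rank v ≤ t} is out-closed, and
-- such sets exist of every size between the two counts.
ranked⇒outClosed-of-size : ∀ {n} (R : Rel₂ n) (rank : Fin n → ℕ) L → (∀ v → rank v < L) →
  (∀ u v → T (R u v) → rank v < rank u) → ∀ {k} → k ≤ n → ∃ λ S → OutClosed R S × count S ≡ k
ranked⇒outClosed-of-size {n} R rank L rank<L descending {k} k≤n =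
  search L (subst (k ≤_) (sym (count-all (λ v → fromWitness (rank<L v)))) k≤n)
  where
  below : ℕ → Fin n → Bool
  below t v = ⌊ rank v <? t ⌋

  between⇒outClosed : ∀ t Q → below t ⊆ᵇ Q → Q ⊆ᵇ below (suc t) → OutClosed R Q
  between⇒outClosed t Q below⊆Q Q⊆below u v u∈Q uv =
    below⊆Q v (fromWitness (<-≤-trans (descending u v uv) (s≤s⁻¹ (toWitness (Q⊆below u u∈Q)))))

  search : ∀ t {k} → k ≤ count (below t) → ∃ λ S → OutClosed R S × count S ≡ k
  search zero {k} k≤0 = below 0 , (λ u _ u∈S _ → ⊥-elim (n≮0 (toWitness {a? = rank u <? 0} u∈S))) ,
    trans ∣below0∣ (sym (n≤0⇒n≡0 (subst (k ≤_) ∣below0∣ k≤0)))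
    where
    ∣below0∣ : count (below 0) ≡ 0
    ∣below0∣ = count-none {g = below 0} (λ v v∈S → n≮0 (toWitness {a? = rank v <? 0} v∈S))
  search (suc t) {k} k≤ with k ≤? count (below t)
  ... | yes k≤′ = search t k≤′
  ... | no  k≰ with Q , below⊆Q , Q⊆below , ∣Q∣ ←
                 subset-between (λ v → fromWitness ∘ m<n⇒m<1+n ∘ toWitness) (<⇒≤ (≰⇒> k≰)) k≤
      = Q , between⇒outClosed t Q below⊆Q Q⊆below , ∣Q∣

functional⇒good⊆positive : ∀ {n} (R : Rel₂ n) (π : Fin n → Fin n) →
  (∀ u v → T (R u v) → v ≡ π u) → ∀ f → good R f ⊆ᵇ f
functional⇒good⊆positive R π R⊆π f v v-good with T? (f v)
... | yes fv  = fv
... | no  ¬fv = ⊥-elim (≤1-positive⇒¬good R f v (π v) (self∈closedNbhd R v) ¬fv only-π v-good)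
  where
  only-π : ∀ u → T (closedNbhd R v u) → T (f u) → u ≡ π v
  only-π u u∈N fu = [ (λ { refl → ⊥-elim (¬fv fu) }) , R⊆π v u ] (∈closedNbhd⇒ R v u u∈N)

orientation-asym : ∀ {n} (G : Rel₂ n) {D} → IsOrientation G D → ∀ {u v} → T (D u v) → ¬ T (D v u)
orientation-asym G (D⊆G , exactly-one) {u} {v} d with exactly-one u v (D⊆G u v d)
... | inj₁ (_ , ¬dvu) = ¬dvu
... | inj₂ (¬duv , _) = contradiction d ¬duv

module DoubleStar (p q : ℕ) where

  G : Rel₂ (2 + p + q)
  G = doubleStar p q

  size : Bool → ℕ
  size false = p
  size true  = q

  centre : Bool → Fin (2 + p + q)
  centre false = zero
  centre true  = suc zero

  leaf : ∀ s → Fin (size s) → Fin (2 + p + q)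
  leaf false i = suc (suc (i ↑ˡ q))
  leaf true  j = suc (suc (p ↑ʳ j))

  star : ∀ s → Fin (suc (size s)) → Fin (2 + p + q)
  star s = centre s Vector.∷ leaf s

  count-stars : ∀ s (g : Fin (2 + p + q) → Bool) →
                count g ≡ count (g ∘ star s) + count (g ∘ star (not s))
  count-stars false g = trans (cong (λ c → a + (b + c)) (count-++ p (λ k → g (suc (suc k)))))
                              (trans (sym (+-assoc a b _)) (interchange a b _ _))
    where a = if g zero then 1 else 0
          b = if g (suc zero) then 1 else 0
  count-stars true g = trans (count-stars false g) (+-comm (count (g ∘ star false)) _)

  data Vertex : Fin (2 + p + q) → Set where
    centreᵛ : ∀ s → Vertex (centre s)
    leafᵛ   : ∀ s i → Vertex (leaf s i)

  vertex : ∀ v → Vertex v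
  vertex zero          = centreᵛ false
  vertex (suc zero)    = centreᵛ true
  vertex (suc (suc k)) with splitAt p k in split
  ... | inj₁ i = subst (λ k → Vertex (suc (suc k))) (Finₚ.splitAt⁻¹-↑ˡ split) (leafᵛ false i)
  ... | inj₂ j = subst (λ k → Vertex (suc (suc k))) (Finₚ.splitAt⁻¹-↑ʳ split) (leafᵛ true j)

  leaf-leaf : ∀ s t i j → ¬ T (G (leaf s i) (leaf t j))
  leaf-leaf false false i j ()
  leaf-leaf false true  i j ()
  leaf-leaf true  false i j ()
  leaf-leaf true  true  i j ()

  adj-sym : ∀ u v → G u v ≡ G v u
  adj-sym u v = ∨-comm (dsEdge p (toℕ u) (toℕ v)) _

  centre-leaf : ∀ s i → T (G (centre s) (leaf s i))
  centre-leaf false i = from T-∨ (inj₁ (fromWitness {a? = toℕ (i ↑ˡ q) <? p}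
    (subst (_< p) (sym (Finₚ.toℕ-↑ˡ i q)) (Finₚ.toℕ<n i))))
  centre-leaf true  j = from T-∨ (inj₁ (fromWitness {a? = p ≤? toℕ (p ↑ʳ j)}
    (subst (p ≤_) (sym (Finₚ.toℕ-↑ʳ p j)) (m≤m+n p _))))

  centre-otherLeaf : ∀ s i → ¬ T (G (centre s) (leaf (not s) i))
  centre-otherLeaf false j e with to T-∨ e
  ... | inj₁ j<p =
    m+n≮m p _ (subst (_< p) (Finₚ.toℕ-↑ʳ p j) (toWitness {a? = toℕ (p ↑ʳ j) <? p} j<p))
  ... | inj₂ ()
  centre-otherLeaf true  i e with to T-∨ e
  ... | inj₁ p≤i =
    <⇒≱ (Finₚ.toℕ<n i) (subst (p ≤_) (Finₚ.toℕ-↑ˡ i q) (toWitness {a? = p ≤? toℕ (i ↑ˡ q)} p≤i))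
  ... | inj₂ ()

  leaf≢centre : ∀ s t i → leaf s i ≢ centre t
  leaf≢centre false false i ()
  leaf≢centre false true  i ()
  leaf≢centre true  false i ()
  leaf≢centre true  true  i ()

  leaf-neighbour : ∀ s i {v} → T (G (leaf s i) v) → v ≡ centre s
  leaf-neighbour s i {v} e with vertex v
  leaf-neighbour s     i e | leafᵛ t j     = ⊥-elim (leaf-leaf s t i j e)
  leaf-neighbour false i e | centreᵛ false = refl
  leaf-neighbour true  i e | centreᵛ true  = refl
  leaf-neighbour false i e | centreᵛ true  =
    ⊥-elim (centre-otherLeaf true i (subst T (adj-sym (leaf false i) (centre true)) e))
  leaf-neighbour true  i e | centreᵛ false =
    ⊥-elim (centre-otherLeaf false i (subst T (adj-sym (leaf true i) (centre false)) e))

  centre-neighbour : ∀ s {v} → T (G (centre s) v) → v ≡ centre (not s) ⊎ ∃ λ i → v ≡ leaf s i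
  centre-neighbour s {v} e with vertex v
  centre-neighbour false e | centreᵛ true    = inj₁ refl
  centre-neighbour true  e | centreᵛ false   = inj₁ refl
  centre-neighbour false e | leafᵛ false i   = inj₂ (i , refl)
  centre-neighbour true  e | leafᵛ true  i   = inj₂ (i , refl)
  centre-neighbour false e | leafᵛ true  i   = ⊥-elim (centre-otherLeaf false i e)
  centre-neighbour true  e | leafᵛ false i   = ⊥-elim (centre-otherLeaf true i e)

  closedNbhd-leaf : ∀ s i u → T (closedNbhd G (leaf s i) u) → u ≡ leaf s i ⊎ u ≡ centre s
  closedNbhd-leaf s i u = map₂ (leaf-neighbour s i) ∘ ∈closedNbhd⇒ G (leaf s i) u

  centre∈closedNbhd-leaf : ∀ s i → T (closedNbhd G (leaf s i) (centre s))
  centre∈closedNbhd-leaf s i =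
    adj⇒∈closedNbhd G (leaf s i) (centre s)
      (subst T (adj-sym (centre s) (leaf s i)) (centre-leaf s i))

  good-leaf⇒positive : ∀ f s i → T (good G f (leaf s i)) → T (f (leaf s i)) × T (f (centre s))
  good-leaf⇒positive f s i leaf-good =
    good⇒positive-in-pair-closedNbhd G f (leaf s i) (centre s) (closedNbhd-leaf s i)
      (self∈closedNbhd G (leaf s i)) leaf-good ,
    good⇒positive-in-pair-closedNbhd G f (centre s) (leaf s i) (λ u → swap ∘ closedNbhd-leaf s i u)
      (centre∈closedNbhd-leaf s i) leaf-good

  -- A good negative centre needs a positive leaf, and then none of its leaves is good.
  star-good≤positive : ∀ f s → count (good G f ∘ star s) ≤ count (f ∘ star s)
  star-good≤positive f s with f (centre s) in fc
  ... | true  = +-mono-≤ (if-≤ (good G f (centre s)) ≤-refl z≤n)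
                         (count-mono λ i → proj₁ ∘ good-leaf⇒positive f s i)
  ... | false rewrite count-none {g = good G f ∘ leaf s} (λ i leaf-good →
                        subst T fc (proj₂ (good-leaf⇒positive f s i leaf-good)))
                    | +-identityʳ (if good G f (centre s) then 1 else 0)
    with good G f (centre s) in gc
  ...   | false = z≤n
  ...   | true with Finₚ.any? (λ i → T? (f (leaf s i)))
  ...     | yes (i , fi) = count-pos i fi
  ...     | no  no-positive-leaf = ⊥-elim (≤1-positive⇒¬good G f (centre s) (centre (not s))
              (self∈closedNbhd G (centre s)) (subst T fc) only-other-centre (subst T (sym gc) _))
    where
    only-other-centre : ∀ u → T (closedNbhd G (centre s) u) → T (f u) → u ≡ centre (not s)
    only-other-centre u u∈N fu with ∈closedNbhd⇒ G (centre s) u u∈N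
    ... | inj₁ refl = ⊥-elim (subst T fc fu)
    ... | inj₂ adj with centre-neighbour s adj
    ...   | inj₁ u≡c′       = u≡c′
    ...   | inj₂ (i , refl) = ⊥-elim (no-positive-leaf (i , fu))

  good≤positive : ∀ f → count (good G f) ≤ count f
  good≤positive f = subst₂ _≤_ (sym (count-stars false (good G f))) (sym (count-stars false f))
    (+-mono-≤ (star-good≤positive f false) (star-good≤positive f true))

  centre≢otherCentre : ∀ s → centre s ≢ centre (not s)
  centre≢otherCentre false ()
  centre≢otherCentre true  ()

  size+size≡p+q : ∀ s → size s + size (not s) ≡ p + q
  size+size≡p+q false = refl
  size+size≡p+q true  = +-comm q p

  p+q≤size+size : ∀ s → size (not s) ≤ size s → p + q ≤ size s + size s
  p+q≤size+size s other≤ = subst (_≤ size s + size s) (size+size≡p+q s) (+-monoʳ-≤ (size s) other≤)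

  count-closedNbhd-centre≤ : ∀ s → count (closedNbhd G (centre s)) ≤ 2 + size s
  count-closedNbhd-centre≤ s = begin
    count N                                      ≡⟨ count-stars s N ⟩
    count (N ∘ star s) + count (N ∘ star (not s)) ≤⟨ +-mono-≤ (count≤k (N ∘ star s))
                                                              (count≤1 zero only-centre) ⟩
    suc (size s) + 1                             ≡⟨ cong suc (+-comm (size s) 1) ⟩
    2 + size s                                   ∎
    where
    open ≤-Reasoning
    N = closedNbhd G (centre s)
    only-centre : ∀ i → T (N (star (not s) i)) → i ≡ zero
    only-centre zero    _   = refl
    only-centre (suc j) j∈N with ∈closedNbhd⇒ G (centre s) (leaf (not s) j) j∈N
    ... | inj₁ leaf≡centre = ⊥-elim (leaf≢centre (not s) s j leaf≡centre)
    ... | inj₂ adj         = ⊥-elim (centre-otherLeaf s j adj)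

  inStar : Bool → Fin (2 + p + q) → Bool
  inStar s u = closedNbhd G (centre s) u ∧ not ⌊ u Finₚ.≟ centre (not s) ⌋

  centre∈inStar : ∀ s → T (inStar s (centre s))
  centre∈inStar s = from T-∧ (self∈closedNbhd G (centre s) , ≢⇒T-not-≟ (centre≢otherCentre s))

  size<count-inStar : ∀ s → size s < count (inStar s)
  size<count-inStar s = begin
    suc (size s)                                            ≡⟨ count-all star⊆inStar ⟨
    count (inStar s ∘ star s)                                ≤⟨ m≤m+n _ _ ⟩
    count (inStar s ∘ star s) + count (inStar s ∘ star (not s)) ≡⟨ count-stars s (inStar s) ⟨
    count (inStar s)                                         ∎
    where
    open ≤-Reasoning
    star⊆inStar : ∀ i → T (inStar s (star s i))
    star⊆inStar zero    = centre∈inStar s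
    star⊆inStar (suc i) = from T-∧ (adj⇒∈closedNbhd G (centre s) (leaf s i) (centre-leaf s i) ,
                                    ≢⇒T-not-≟ (leaf≢centre s (not s) i))

  -- The centre is good because all positives lie in its closed neighbourhood, which misses
  -- the (nonempty) other star.
  ⌈n/2⌉-in-star⇒good : ∀ s → 1 ≤ size (not s) → ∀ Q → T (Q (centre s)) → Q ⊆ᵇ inStar s →
                       count Q ≡ ⌈ 2 + p + q /2⌉ → Q ⊆ᵇ good G Q
  ⌈n/2⌉-in-star⇒good s other≥1 Q c∈Q Q⊆star ∣Q∣ u u∈Q
    with u∈N , u≢c′ ← to T-∧ (Q⊆star u u∈Q) | ∈closedNbhd⇒ G (centre s) u u∈N
  ... | inj₁ refl = centre-good
    where
    open ≤-Reasoning
    N = closedNbhd G (centre s)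
    positive = count (λ u → N u ∧ Q u)
    negative = count (λ u → N u ∧ not (Q u))
    positive≡ : positive ≡ ⌈ 2 + p + q /2⌉
    positive≡ = trans (count-cong {g = λ u → N u ∧ Q u} {h = Q} (λ u → proj₂ ∘ to (T-∧ {N u}))
                        (λ u u∈Q → from T-∧ (proj₁ (to T-∧ (Q⊆star u u∈Q)) , u∈Q))) ∣Q∣
    centre-good : T (good G Q (centre s))
    centre-good = from (good⇔more-positive G Q (centre s)) (+-cancelˡ-< positive _ _ (begin-strict
      positive + negative               ≡⟨ count-split N Q ⟨
      count N                           ≤⟨ count-closedNbhd-centre≤ s ⟩
      2 + size s                        <⟨ +-monoʳ-< 2 (m<m+n (size s) other≥1) ⟩
      2 + (size s + size (not s))       ≡⟨ cong (2 +_) (size+size≡p+q s) ⟩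
      2 + (p + q)                       ≤⟨ n≤⌈n/2⌉+⌈n/2⌉ (2 + p + q) ⟩
      ⌈ 2 + p + q /2⌉ + ⌈ 2 + p + q /2⌉ ≡⟨ cong₂ _+_ positive≡ positive≡ ⟨
      positive + positive               ∎))
  ... | inj₂ adj with centre-neighbour s adj
  ...   | inj₁ refl       = ⊥-elim (to T-not⇔¬T u≢c′ (fromWitness {a? = u Finₚ.≟ u} refl))
  ...   | inj₂ (i , refl) = closedNbhd⊆positive⇒good G Q (leaf s i) λ w w∈N →
            [ (λ { refl → u∈Q }) , (λ { refl → c∈Q }) ] (closedNbhd-leaf s i w w∈N)

  balanced-good-function : ∀ s → 1 ≤ size (not s) → size (not s) ≤ size s →
                           ∃ λ f → count f ≡ ⌈ 2 + p + q /2⌉ × f ⊆ᵇ good G f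
  balanced-good-function s other≥1 other≤ with Q , c⊆Q , Q⊆star , ∣Q∣ ←
      subset-between {S = λ u → ⌊ u Finₚ.≟ centre s ⌋} {P = inStar s}
        (λ u u≡c → subst (T ∘ inStar s) (sym (toWitness {a? = u Finₚ.≟ centre s} u≡c))
                         (centre∈inStar s))
        (≤-trans (count≤1 (centre s) (λ u → toWitness {a? = u Finₚ.≟ centre s})) (s≤s z≤n))
        (≤-trans (s≤s (⌈n/2⌉≤m (p+q≤size+size s other≤))) (size<count-inStar s))
    = Q , ∣Q∣ , ⌈n/2⌉-in-star⇒good s other≥1 Q
                  (c⊆Q (centre s) (fromWitness {a? = centre s Finₚ.≟ centre s} refl)) Q⊆star ∣Q∣

  parent : Fin (2 + p + q) → Fin (2 + p + q)
  parent zero          = centre false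
  parent (suc zero)    = centre false
  parent (suc (suc k)) = [ (λ _ → centre false) , (λ _ → centre true) ] (splitAt p k)

  parent-leaf : ∀ s i → parent (leaf s i) ≡ centre s
  parent-leaf false i rewrite Finₚ.splitAt-↑ˡ p i q = refl
  parent-leaf true  j rewrite Finₚ.splitAt-↑ʳ p q j = refl

  rootward : Rel₂ (2 + p + q)
  rootward u v = ⌊ v Finₚ.≟ parent u ⌋ ∧ G u v

  rootward-functional : ∀ u v → T (rootward u v) → v ≡ parent u
  rootward-functional u v = toWitness {a? = v Finₚ.≟ parent u} ∘ proj₁ ∘ to T-∧

  rootward-leaf : ∀ s i → T (rootward (leaf s i) (centre s))
  rootward-leaf s i = from T-∧ (fromWitness (sym (parent-leaf s i)) ,
                                subst T (adj-sym (centre s) (leaf s i)) (centre-leaf s i))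

  ¬rootward-centre-leaf : ∀ s i → ¬ T (rootward (centre s) (leaf s i))
  ¬rootward-centre-leaf s i r =
    leaf≢centre s false i (trans (rootward-functional (centre s) (leaf s i) r) (parent-centre s))
    where parent-centre : ∀ s → parent (centre s) ≡ centre false
          parent-centre false = refl
          parent-centre true  = refl

  rootward-orientation : IsOrientation G rootward
  rootward-orientation = (λ u v → proj₂ ∘ to T-∧) , exactly-one
    where
    Exactly-one : Fin (2 + p + q) → Fin (2 + p + q) → Set
    Exactly-one u v =
      (T (rootward u v) × ¬ T (rootward v u)) ⊎ (¬ T (rootward u v) × T (rootward v u))
    centre-edge : ∀ s → Exactly-one (centre s) (centre (not s))
    centre-edge false = inj₂ ((λ ()) , _)
    centre-edge true  = inj₁ (_ , (λ ()))
    exactly-one : ∀ u v → T (G u v) → Exactly-one u v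
    exactly-one u v e with vertex u
    ... | leafᵛ s i with refl ← leaf-neighbour s i e =
      inj₁ (rootward-leaf s i , ¬rootward-centre-leaf s i)
    ... | centreᵛ s with centre-neighbour s e
    ...   | inj₁ refl       = centre-edge s
    ...   | inj₂ (i , refl) = inj₂ (¬rootward-centre-leaf s i , rootward-leaf s i)

  module _ (D : Rel₂ (2 + p + q)) where

    -- Ranks making every arc of an orientation descend: a leaf pointing to its centre (3),
    -- the tail (2) and head (1) of the central arc, a leaf pointed at (0).
    level : Fin (2 + p + q) → ℕ
    level zero          = if D zero (suc zero) then 2 else 1
    level (suc zero)    = if D (suc zero) zero then 2 else 1
    level (suc (suc k)) = if D (suc (suc k)) (parent (suc (suc k))) then 3 else 0

    level-centre : ∀ s → level (centre s) ≡ (if D (centre s) (centre (not s)) then 2 else 1)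
    level-centre false = refl
    level-centre true  = refl

    level-leaf : ∀ s i → level (leaf s i) ≡ (if D (leaf s i) (centre s) then 3 else 0)
    level-leaf false i = cong (λ c → if D (leaf false i) c then 3 else 0) (parent-leaf false i)
    level-leaf true  i = cong (λ c → if D (leaf true i) c then 3 else 0) (parent-leaf true i)

    centre-level-bounds : ∀ s → 1 ≤ level (centre s) × level (centre s) ≤ 2
    centre-level-bounds s rewrite level-centre s with D (centre s) (centre (not s))
    ... | true  = s≤s z≤n , ≤-refl
    ... | false = ≤-refl , s≤s z≤n

    level<4 : ∀ v → level v < 4
    level<4 zero          = s≤s (if-≤ (D zero (suc zero)) (s≤s (s≤s z≤n)) (s≤s z≤n))
    level<4 (suc zero)    = s≤s (if-≤ (D (suc zero) zero) (s≤s (s≤s z≤n)) (s≤s z≤n))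
    level<4 (suc (suc k)) = s≤s (if-≤ (D (suc (suc k)) (parent (suc (suc k)))) ≤-refl z≤n)

    centre-arc-descending : IsOrientation G D → ∀ s →
      T (D (centre s) (centre (not s))) → level (centre (not s)) < level (centre s)
    centre-arc-descending oD false d =
      subst₂ _<_ (sym (if-¬T (orientation-asym G oD d))) (sym (if-T d)) (s≤s (s≤s z≤n))
    centre-arc-descending oD true  d =
      subst₂ _<_ (sym (if-¬T (orientation-asym G oD d))) (sym (if-T d)) (s≤s (s≤s z≤n))

    level-descending : IsOrientation G D → ∀ u v → T (D u v) → level v < level u
    level-descending oD@(D⊆G , _) u v d with vertex u
    ... | leafᵛ s i with refl ← leaf-neighbour s i (D⊆G _ _ d) =
      subst (level (centre s) <_) (sym (trans (level-leaf s i) (if-T d)))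
            (s≤s (proj₂ (centre-level-bounds s)))
    ... | centreᵛ s with centre-neighbour s (D⊆G _ _ d)
    ...   | inj₁ refl       = centre-arc-descending oD s d
    ...   | inj₂ (i , refl) =
      subst (_< level (centre s)) (sym (trans (level-leaf s i) (if-¬T (orientation-asym G oD d))))
            (proj₁ (centre-level-bounds s))

  orientation-balanced : ∀ D → IsOrientation G D → ∃ λ f → count f ≡ ⌈ 2 + p + q /2⌉ × f ⊆ᵇ good D f
  orientation-balanced D oD
    with S , closed , ∣S∣ ←
      ranked⇒outClosed-of-size D (level D) 4 (level<4 D) (level-descending D oD) (⌈n/2⌉≤n (2 + p + q))
    = S , ∣S∣ , outClosed⇒positive⊆good D S closed

  largest-star : 1 ≤ p → 1 ≤ q → ∃ λ s → 1 ≤ size (not s) × size (not s) ≤ size s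
  largest-star p≥1 q≥1 with ≤-total p q
  ... | inj₁ p≤q = true  , p≥1 , p≤q
  ... | inj₂ q≤p = false , q≥1 , q≤p

proposition4p7 : (p q : ℕ) → p ≥ 1 → q ≥ 1 →
    Σ ℤ (λ k → IsGammaMaj (doubleStar p q) k × IsDOMOutMaj (doubleStar p q) k)
proposition4p7 p q p≥1 q≥1 =
  ℤ.+ ((2 + p + q) % 2) , γ-G , (rootward , rootward-orientation , γ⁺-rootward) , γ⁺≤
  where
  open DoubleStar p q
  γ-G : IsGammaMaj G (ℤ.+ ((2 + p + q) % 2))
  γ-G = parity-isMinMajWeight G good≤positive
          (let s , other≥1 , other≤ = largest-star p≥1 q≥1
           in balanced-good-function s other≥1 other≤)
  γ⁺-rootward : IsGammaOutMaj rootward (ℤ.+ ((2 + p + q) % 2))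
  γ⁺-rootward = parity-isMinMajWeight rootward
    (λ f → count-mono (functional⇒good⊆positive rootward parent rootward-functional f))
    (orientation-balanced rootward rootward-orientation)
  γ⁺≤ : ∀ D k → IsOrientation G D → IsGammaOutMaj D k → k ℤ.≤ ℤ.+ ((2 + p + q) % 2)
  γ⁺≤ D k oD (_ , minimal) =
    let f , ∣f∣ , f⊆good     = orientation-balanced D oD
        majority , weight≡ = ⌈n/2⌉-good-positives⇒isMajDom D f ∣f∣ f⊆good
    in subst (k ℤ.≤_) weight≡ (minimal f majority)
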